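{- Let $A,B$ be finite sets of primes with $|A|\le|B|$ and $A\ne B$. If $\min(B\setminus A)>\max(A)$, then $\prod_{q\in B}(q-1)>\prod_{q\in A}(q-1)$. -}

module Defs where

open import Data.Nat using (ℕ; _∸_)
open import Data.List using (List; map)
open import Data.Nat.ListAction using (product)

-- product over q ∈ S of (q - 1), for a finite set S of naturals given as a duplicate-free list
prodPred : List ℕ → ℕ
prodPred S = product (map (λ q → q ∸ 1) S)

-- Split A and B into their common part C = A ∩ B and the differences A ∖ B and B ∖ A.
-- The factor over C is shared and positive, and |A ∖ B| ≤ |B ∖ A| because |A| ≤ |B|.
-- With M = max A, every a ∈ A ∖ B has a - 1 ≤ M - 1 while every b ∈ B ∖ A has b - 1 ≥ M,
-- so the remaining factors compare as (M - 1)^|A ∖ B| ≤ (M - 1)^|B ∖ A| < M^|B ∖ A|;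
-- the strict step needs B ∖ A ≠ ∅, which holds since otherwise also A ∖ B = ∅ and A = B.
module Submission where

open import Defs
open import Data.Nat using (ℕ; _<_; _≤_; _∸_; _*_; _+_; _^_; NonZero; z<s; >-nonZero; nonTrivial⇒n>1)
open import Data.Nat.Properties
open import Data.Nat.Primality using (Prime; prime⇒nonTrivial)
open import Data.Nat.ListAction using (product)
open import Data.Nat.ListAction.Properties using (product-++; product-↭; product≢0)
open import Data.List using (List; length; []; _∷_; _++_; filter; map)
open import Data.List.Properties using (map-++; length-++)
open import Data.List.Extrema.Nat using (max; xs≤max; v<max⁺; max<v⁺)
open import Data.List.Relation.Unary.All using (All; []; _∷_)
import Data.List.Relation.Unary.All as All
import Data.List.Relation.Unary.All.Properties as All
open import Data.List.Relation.Unary.Any using (here)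
open import Data.List.Relation.Unary.Unique.Propositional using (Unique)
import Data.List.Relation.Unary.Unique.Propositional.Properties as Unique
open import Data.List.Relation.Binary.Subset.Propositional using (_⊆_)
open import Data.List.Membership.Propositional using (_∈_; _∉_)
open import Data.List.Membership.Propositional.Properties using (∈-filter⁺; ∈-filter⁻; ∈-length)
open import Data.List.Membership.Propositional.Properties.WithK using (unique∧set⇒bag)
open import Data.List.Membership.DecPropositional _≟_ using (_∈?_; _∉?_)
open import Data.List.Relation.Binary.BagAndSetEquality using (∼bag⇒↭)
open import Data.List.Relation.Binary.Permutation.Propositional using (_↭_; ↭-refl; prep; ↭-trans; ↭-sym)
open import Data.List.Relation.Binary.Permutation.Propositional.Properties
  using (shift; ++⁺ʳ; ↭-length)
import Data.List.Relation.Binary.Permutation.Propositional.Properties as ↭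
open import Data.Bool using (true; false)
open import Data.Product using (_×_; _,_)
open import Data.Sum using (inj₁)
open import Function.Bundles using (mk⇔)
open import Level using (Level)
open import Relation.Binary.PropositionalEquality using (_≡_; _≢_; refl; cong; trans)
open import Relation.Nullary using (¬_; yes; no; does; contradiction)
open import Relation.Unary using (Pred; Decidable)
open import Relation.Unary.Properties using (∁?)

module _ {a p : Level} {A : Set a} {P : Pred A p} (P? : Decidable P) where

  ↭-filter-++-filter-∁ : ∀ xs → xs ↭ filter P? xs ++ filter (∁? P?) xs
  ↭-filter-++-filter-∁ [] = ↭-refl
  ↭-filter-++-filter-∁ (x ∷ xs) with does (P? x)
  ... | true  = prep x (↭-filter-++-filter-∁ xs)
  ... | false = ↭-trans (prep x (↭-filter-++-filter-∁ xs)) (↭-sym (shift x (filter P? xs) _))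

infixl 7 _∩_
infixl 6 _∖_

_∩_ : List ℕ → List ℕ → List ℕ
xs ∩ ys = filter (_∈? ys) xs

_∖_ : List ℕ → List ℕ → List ℕ
xs ∖ ys = filter (_∉? ys) xs

↭-∩-++-∖ : ∀ xs ys → xs ↭ xs ∩ ys ++ xs ∖ ys
↭-∩-++-∖ xs ys = ↭-filter-++-filter-∁ (_∈? ys) xs

∈-∩-comm : ∀ {x xs ys} → x ∈ xs ∩ ys → x ∈ ys ∩ xs
∈-∩-comm {xs = xs} {ys} x∈ with x∈xs , x∈ys ← ∈-filter⁻ (_∈? ys) x∈ = ∈-filter⁺ (_∈? xs) x∈ys x∈xs

∩-comm-↭ : ∀ {xs ys} → Unique xs → Unique ys → xs ∩ ys ↭ ys ∩ xs
∩-comm-↭ {xs} {ys} !xs !ys = ∼bag⇒↭ (unique∧set⇒bag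
  (Unique.filter⁺ (_∈? ys) !xs) (Unique.filter⁺ (_∈? xs) !ys) (mk⇔ (∈-∩-comm {xs = xs}) (∈-∩-comm {xs = ys})))

↭-∩ʳ-++-∖ : ∀ {xs ys} → Unique xs → Unique ys → ys ↭ xs ∩ ys ++ ys ∖ xs
↭-∩ʳ-++-∖ {xs} {ys} !xs !ys = ↭-trans (↭-∩-++-∖ ys xs) (++⁺ʳ (ys ∖ xs) (∩-comm-↭ !ys !xs))

length-∖-≤ : ∀ {xs ys} → Unique xs → Unique ys →
             length xs ≤ length ys → length (xs ∖ ys) ≤ length (ys ∖ xs)
length-∖-≤ {xs} {ys} !xs !ys |xs|≤|ys| = +-cancelˡ-≤ (length (xs ∩ ys)) _ _ (begin
  length (xs ∩ ys) + length (xs ∖ ys)  ≡⟨ length-++ (xs ∩ ys) ⟨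
  length (xs ∩ ys ++ xs ∖ ys)          ≡⟨ ↭-length (↭-∩-++-∖ xs ys) ⟨
  length xs                            ≤⟨ |xs|≤|ys| ⟩
  length ys                            ≡⟨ ↭-length (↭-∩ʳ-++-∖ !xs !ys) ⟩
  length (xs ∩ ys ++ ys ∖ xs)          ≡⟨ length-++ (xs ∩ ys) ⟩
  length (xs ∩ ys) + length (ys ∖ xs)  ∎)
  where open ≤-Reasoning

length-∖≡0⇒⊆ : ∀ {xs ys} → length (xs ∖ ys) ≡ 0 → xs ⊆ ys
length-∖≡0⇒⊆ {xs} {ys} |xs∖ys|≡0 {x} x∈xs with x ∈? ys
... | yes x∈ys = x∈ys
... | no  x∉ys = contradiction |xs∖ys|≡0 (>⇒≢ (∈-length (∈-filter⁺ (_∉? ys) x∈xs x∉ys)))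

prodPred-++ : ∀ xs ys → prodPred (xs ++ ys) ≡ prodPred xs * prodPred ys
prodPred-++ xs ys = trans (cong product (map-++ (_∸ 1) xs ys)) (product-++ (map (_∸ 1) xs) (map (_∸ 1) ys))

prodPred-↭ : ∀ {xs ys} → xs ↭ ys → prodPred xs ≡ prodPred ys
prodPred-↭ xs↭ys = product-↭ (↭.map⁺ (_∸ 1) xs↭ys)

prodPred-nonZero : ∀ {xs} → All (1 <_) xs → NonZero (prodPred xs)
prodPred-nonZero 1<xs = product≢0 (All.map⁺ (All.map (λ 1<x → >-nonZero (m<n⇒0<n∸m 1<x)) 1<xs))

prodPred≤^length : ∀ {M xs} → All (_≤ M) xs → prodPred xs ≤ (M ∸ 1) ^ length xs
prodPred≤^length []            = ≤-refl
prodPred≤^length (x≤M ∷ xs≤M) = *-mono-≤ (∸-monoˡ-≤ 1 x≤M) (prodPred≤^length xs≤M)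

^length≤prodPred : ∀ {M ys} → All (M <_) ys → M ^ length ys ≤ prodPred ys
^length≤prodPred []            = ≤-refl
^length≤prodPred (M<y ∷ M<ys) = *-mono-≤ (∸-monoˡ-≤ 1 M<y) (^length≤prodPred M<ys)

prodPred-<-separated : ∀ {M xs ys} → 1 < M → All (_≤ M) xs → All (M <_) ys →
                       0 < length ys → length xs ≤ length ys → prodPred xs < prodPred ys
prodPred-<-separated {M} {xs} {ys} 1<M xs≤M M<ys 0<|ys| |xs|≤|ys| = begin-strict
  prodPred xs          ≤⟨ prodPred≤^length xs≤M ⟩
  (M ∸ 1) ^ length xs  ≤⟨ ^-monoʳ-≤ (M ∸ 1) {{>-nonZero (m<n⇒0<n∸m 1<M)}} |xs|≤|ys| ⟩
  (M ∸ 1) ^ length ys  <⟨ ^-monoˡ-< (length ys) {{>-nonZero 0<|ys|}} (∸-monoʳ-< z<s (<⇒≤ 1<M)) ⟩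
  M ^ length ys        ≤⟨ ^length≤prodPred M<ys ⟩
  prodPred ys          ∎
  where open ≤-Reasoning

prime⇒1< : ∀ {p} → Prime p → 1 < p
prime⇒1< {p} p-prime = nonTrivial⇒n>1 p {{prime⇒nonTrivial p-prime}}

lemma6 : (A B : List ℕ) → Unique A → Unique B → All Prime A → All Prime B →
    A ≢ [] → length A ≤ length B →
    ¬ (∀ x → (x ∈ A → x ∈ B) × (x ∈ B → x ∈ A)) →
    (∀ b → b ∈ B → b ∉ A → ∀ a → a ∈ A → a < b) →
    prodPred A < prodPred B
lemma6 [] B _ _ _ _ A≢[] _ _ _ = contradiction refl A≢[]
lemma6 A@(a ∷ _) B !A !B prime-A@(prime-a ∷ _) _ _ |A|≤|B| A≉B A<B∖A = begin-strict
  prodPred A                                ≡⟨ prodPred-↭ (↭-∩-++-∖ A B) ⟩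
  prodPred (A ∩ B ++ A ∖ B)                 ≡⟨ prodPred-++ (A ∩ B) (A ∖ B) ⟩
  prodPred (A ∩ B) * prodPred (A ∖ B)       <⟨ *-monoʳ-< (prodPred (A ∩ B)) {{common≢0}} differences-< ⟩
  prodPred (A ∩ B) * prodPred (B ∖ A)       ≡⟨ prodPred-++ (A ∩ B) (B ∖ A) ⟨
  prodPred (A ∩ B ++ B ∖ A)                 ≡⟨ prodPred-↭ (↭-∩ʳ-++-∖ !A !B) ⟨
  prodPred B                                ∎
  where
  open ≤-Reasoning
  M = max a A
  common≢0 : NonZero (prodPred (A ∩ B))
  common≢0 = prodPred-nonZero (All.filter⁺ (_∈? B) (All.map prime⇒1< prime-A))
  M<B∖A : All (M <_) (B ∖ A)
  M<B∖A = All.tabulate λ b∈B∖A → let b∈B , b∉A = ∈-filter⁻ (_∉? A) b∈B∖A in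
    max<v⁺ (A<B∖A _ b∈B b∉A a (here refl)) (All.tabulate (A<B∖A _ b∈B b∉A _))
  |A∖B|≤|B∖A| : length (A ∖ B) ≤ length (B ∖ A)
  |A∖B|≤|B∖A| = length-∖-≤ !A !B |A|≤|B|
  0<|B∖A| : 0 < length (B ∖ A)
  0<|B∖A| = n≢0⇒n>0 λ |B∖A|≡0 → A≉B λ x →
    length-∖≡0⇒⊆ (n≤0⇒n≡0 (≤-trans |A∖B|≤|B∖A| (≤-reflexive |B∖A|≡0))) , length-∖≡0⇒⊆ |B∖A|≡0
  differences-< : prodPred (A ∖ B) < prodPred (B ∖ A)
  differences-< = prodPred-<-separated (v<max⁺ a A (inj₁ (prime⇒1< prime-a)))
    (All.filter⁺ (_∉? B) (xs≤max a A)) M<B∖A 0<|B∖A| |A∖B|≤|B∖A|
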